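{- Let $\kappa$ be a regular cardinal, $\Sigma$ an $S$-sorted signature of $\kappa$-ary algebra and $\mathcal{T}$ a $\kappa$-ary Horn theory. For every pair $(G,\mathcal{R})$ consisting of an $S$-sorted set $G$ of generators and an $S$-sorted set $\mathcal{R}=(\mathcal{R}_s\subseteq\mathrm{Term}^s_\Sigma(G)\times\mathrm{Term}^s_\Sigma(G))_{s\in S}$ of relations, there is a model $(A,\varrho)$ of $(G,\mathcal{R})$ in $\mathbf{PAlg}(\Sigma,\mathcal{T})$ that is presented by $(G,\mathcal{R})$.
   Context: Signatures: operation symbols with sorts $\prod_{i<\alpha}s_i\to s$, $\alpha<\kappa$. $\mathrm{Term}^s_\Sigma(G)$ is the set of terms of sort $s$ built from elements of $G$ (as variables) and operation symbols. A partial algebra $A$ has carriers $A_s$ and partial functions $\sigma_A:\prod_iA_{s_i}\rightharpoonup A_s$; a homomorphism is a family of total functions $h_s$ with: if $\sigma_A(a_i)_i$ is defined then $\sigma_B(h(a_i))_i$ is defined and equals $h(\sigma_A(a_i)_i)$. A $\kappa$-ary Horn formula is $\forall(x_i:s_i)_{i<\alpha}.\bigwedge_{j<\beta}t_j=t'_j\Rightarrow t=t'$ ($\alpha,\beta<\kappa$), where $e=e'$ holds iff both sides are defined and equal; $\mathbf{PAlg}(\Sigma,\mathcal{T})$ is the category of partial algebras satisfying all formulas of $\mathcal{T}$, with homomorphisms. A model of $(G,\mathcal{R})$ in $\mathbf{PAlg}(\Sigma,\mathcal{T})$ is a pair $(A,\varrho)$ with $A\in\mathbf{PAlg}(\Sigma,\mathcal{T})$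 and functions $\varrho_s:G_s\to A_s$ such that for every $(t,t')\in\mathcal{R}_s$, the interpretations of $t$ and $t'$ under $\varrho$ are both defined and equal. A model $(A,\varrho)$ is presented by $(G,\mathcal{R})$ if for every model $(B,\vartheta)$ there is a unique homomorphism $h:A\to B$ with $\vartheta_s=h_s\circ\varrho_s$ for all $s$. -}

module Defs where

open import Data.Product using (Σ; _×_; _,_; ∃; ∃-syntax)
open import Relation.Binary.Structures using (IsEquivalence)

record Signature : Set₁ where
  field
    Sort  : Set
    Op    : Set
    arity : Op → Set
    dom   : (σ : Op) → arity σ → Sort
    cod   : Op → Sort

module _ (Sg : Signature) where
  open Signature Sg

  data Term (X : Sort → Set) : Sort → Set where
    var : ∀ {s} → X s → Term X s
    op  : (σ : Op) → ((i : arity σ) → Term X (dom σ i)) → Term X (cod σ)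

  record Horn : Set₁ where
    field
      Vars  : Sort → Set
      Prem  : Set
      psort : Prem → Sort
      plhs  : (j : Prem) → Term Vars (psort j)
      prhs  : (j : Prem) → Term Vars (psort j)
      csort : Sort
      clhs  : Term Vars csort
      crhs  : Term Vars csort

  record Theory : Set₁ where
    field
      Ax  : Set
      ax  : Ax → Horn

  -- Partial Σ-algebra, with carriers given as setoids (no quotients in Agda).
  -- The partial operation σ_A is given by its domain Def σ and its value app σ.
  record PAlg : Set₁ where
    field
      Car     : Sort → Set
      _≈_     : ∀ {s} → Car s → Car s → Set
      isEquiv : ∀ s → IsEquivalence (_≈_ {s})
      Def     : (σ : Op) → ((i : arity σ) → Car (dom σ i)) → Set
      app     : (σ : Op) (as : (i : arity σ) → Car (dom σ i)) → Def σ as → Car (cod σ)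
      Def-resp : (σ : Op) {as bs : (i : arity σ) → Car (dom σ i)} →
                 (∀ i → as i ≈ bs i) → Def σ as → Def σ bs
      app-resp : (σ : Op) {as bs : (i : arity σ) → Car (dom σ i)} →
                 (∀ i → as i ≈ bs i) → (d : Def σ as) (e : Def σ bs) →
                 app σ as d ≈ app σ bs e

  module _ (A : PAlg) where
    open PAlg A

    data Eval {X : Sort → Set} (ρ : ∀ {s} → X s → Car s) : ∀ {s} → Term X s → Car s → Set where
      var⇓ : ∀ {s} (x : X s) → Eval ρ (var x) (ρ x)
      op⇓  : (σ : Op) {ts : (i : arity σ) → Term X (dom σ i)}
             (as : (i : arity σ) → Car (dom σ i)) →
             (∀ i → Eval ρ (ts i) (as i)) → (d : Def σ as) →
             Eval ρ (op σ ts) (app σ as d)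

    EqHolds : {X : Sort → Set} (ρ : ∀ {s} → X s → Car s) {s : Sort} →
              Term X s → Term X s → Set
    EqHolds ρ t t' = ∃[ a ] ∃[ b ] (Eval ρ t a × Eval ρ t' b × a ≈ b)

    SatisfiesHorn : Horn → Set
    SatisfiesHorn φ = (ρ : ∀ {s} → Vars s → Car s) →
                      (∀ j → EqHolds ρ (plhs j) (prhs j)) →
                      EqHolds ρ clhs crhs
      where open Horn φ

    Satisfies : Theory → Set
    Satisfies T = (a : Theory.Ax T) → SatisfiesHorn (Theory.ax T a)

  record Hom (A B : PAlg) : Set where
    private
      module A = PAlg A
      module B = PAlg B
    field
      map      : ∀ s → A.Car s → B.Car s
      map-resp : ∀ s {a a' : A.Car s} → a A.≈ a' → map s a B.≈ map s a'
      preserve : (σ : Op) (as : (i : arity σ) → A.Car (dom σ i)) (d : A.Def σ as) →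
                 Σ (B.Def σ (λ i → map (dom σ i) (as i))) λ e →
                   map (cod σ) (A.app σ as d) B.≈ B.app σ (λ i → map (dom σ i) (as i)) e

  record Model (T : Theory) : Set₁ where
    field
      alg : PAlg
      sat : Satisfies alg T

  module _ (T : Theory) (G : Sort → Set)
           (R : (s : Sort) → Term G s → Term G s → Set) where

    record PresModel : Set₁ where
      field
        model : Model T
      open Model model public
      field
        ϱ      : ∀ {s} → G s → PAlg.Car alg s
        relsat : ∀ s (t t' : Term G s) → R s t t' → EqHolds alg ϱ t t'

    -- (A, ϱ) is presented by (G, R): universal among models of (G, R),
    -- with uniqueness up to the (setoid) equality of the target.
    IsPresented : PresModel → Set₁
    IsPresented M = (N : PresModel) →
      Σ (Hom (PresModel.alg M) (PresModel.alg N)) λ h →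
        ((∀ s (g : G s) → PAlg._≈_ (PresModel.alg N)
                             (Hom.map h s (PresModel.ϱ M g)) (PresModel.ϱ N g))
        × ((h' : Hom (PresModel.alg M) (PresModel.alg N)) →
           (∀ s (g : G s) → PAlg._≈_ (PresModel.alg N)
                               (Hom.map h' s (PresModel.ϱ M g)) (PresModel.ϱ N g)) →
           ∀ s (a : PAlg.Car (PresModel.alg M) s) →
             PAlg._≈_ (PresModel.alg N) (Hom.map h s a) (Hom.map h' s a)))

-- The presented model is the term model of the partial Horn calculus: ground terms t with t ≐ t derivable
-- (the defined terms), identified when t ≐ u is derivable. It satisfies T because the calculus has a rule for
-- each axiom, and it satisfies R by the rule for relations. The calculus is sound in every model (B, ϑ) of
-- (G, R) under the valuation ϑ, so a defined term t has a value in B; sending t to it is the homomorphism.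
-- It is unique since every homomorphism preserves evaluation and therefore sends t to that same value.
module Submission where

open import Defs
open import Data.Product using (Σ; _×_; _,_; proj₁; proj₂; ∃-syntax)
open import Relation.Binary.Structures using (IsEquivalence)

module Substitution (Sg : Signature) where
  open Signature Sg

  _[_] : {X Y : Sort → Set} {s : Sort} → Term Sg X s → (∀ {s} → X s → Term Sg Y s) → Term Sg Y s
  infixl 25 _[_]

  var x    [ θ ] = θ x
  op σ ts  [ θ ] = op σ (λ i → ts i [ θ ])

module Evaluation {Sg : Signature} (B : PAlg Sg) where
  open Signature Sg
  open PAlg B
  open Substitution Sg
  private
    module ≈ {s} = IsEquivalence (isEquiv s)
    variable
      X Y : Sort → Set
      s : Sort
      σ : Op
      ρ : ∀ {s} → X s → Car s
      t u : Term Sg X s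
      a b : Car s

  Eval≈ : (ρ : ∀ {s} → X s → Car s) → Term Sg X s → Car s → Set
  Eval≈ ρ t a = ∃[ b ] (Eval Sg B ρ t b × b ≈ a)

  Eval-functional : Eval Sg B ρ t a → Eval Sg B ρ t b → a ≈ b
  Eval-functional (var⇓ x)          (var⇓ _)          = ≈.refl
  Eval-functional (op⇓ σ as eas d) (op⇓ _ bs ebs e) =
    app-resp σ (λ i → Eval-functional (eas i) (ebs i)) d e

  Eval-op⁻¹ : {ts : (i : arity σ) → Term Sg X (dom σ i)} → Eval Sg B ρ (op σ ts) a →
              ∃[ as ] ((∀ i → Eval Sg B ρ (ts i) (as i)) × Def σ as)
  Eval-op⁻¹ (op⇓ σ as eas d) = as , eas , d

  Eval⇒Eval≈ : Eval Sg B ρ t a → Eval≈ ρ t a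
  Eval⇒Eval≈ e = _ , e , ≈.refl

  Eval≈-functional : Eval≈ ρ t a → Eval≈ ρ t b → a ≈ b
  Eval≈-functional (a' , ea , a'≈a) (b' , eb , b'≈b) =
    ≈.trans (≈.sym a'≈a) (≈.trans (Eval-functional ea eb) b'≈b)

  Eval≈-resp : Eval≈ ρ t a → a ≈ b → Eval≈ ρ t b
  Eval≈-resp (a' , ea , a'≈a) a≈b = a' , ea , ≈.trans a'≈a a≈b

  Eval≈-op : {ts : (i : arity σ) → Term Sg X (dom σ i)} {as : (i : arity σ) → Car (dom σ i)} →
             (∀ i → Eval≈ ρ (ts i) (as i)) → (d : Def σ as) → Eval≈ ρ (op σ ts) (app σ as d)
  Eval≈-op {σ = σ} args d =
    app σ bs e , op⇓ σ bs (λ i → proj₁ (proj₂ (args i))) e , app-resp σ bs≈as e d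
    where
    bs = λ i → proj₁ (args i)
    bs≈as = λ i → proj₂ (proj₂ (args i))
    e = Def-resp σ (λ i → ≈.sym (bs≈as i)) d

  Eval-resp-valuation : {ρ' : ∀ {s} → X s → Car s} → (∀ {s} (x : X s) → ρ x ≈ ρ' x) →
                        Eval Sg B ρ t a → Eval≈ ρ' t a
  Eval-resp-valuation ρ≈ρ' (var⇓ x)         = _ , var⇓ x , ≈.sym (ρ≈ρ' x)
  Eval-resp-valuation ρ≈ρ' (op⇓ σ as eas d) = Eval≈-op (λ i → Eval-resp-valuation ρ≈ρ' (eas i)) d

  EqHolds-intro : Eval≈ ρ t a → Eval≈ ρ u b → a ≈ b → EqHolds Sg B ρ t u
  EqHolds-intro (a' , ea , a'≈a) (b' , eb , b'≈b) a≈b =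
    a' , b' , ea , eb , ≈.trans a'≈a (≈.trans a≈b (≈.sym b'≈b))

  module _ {θ : ∀ {s} → X s → Term Sg Y s} {ρ : ∀ {s} → Y s → Car s} {ρθ : ∀ {s} → X s → Car s}
           (θ⇓ρθ : ∀ {s} (x : X s) → Eval≈ ρ (θ x) (ρθ x)) where

    Eval-subst⁻ : (t : Term Sg X s) → Eval Sg B ρ (t [ θ ]) a → Eval≈ ρθ t a
    Eval-subst⁻ (var x)   e                = ρθ x , var⇓ x , Eval≈-functional (θ⇓ρθ x) (Eval⇒Eval≈ e)
    Eval-subst⁻ (op σ ts) (op⇓ _ as eas d) = Eval≈-op (λ i → Eval-subst⁻ (ts i) (eas i)) d

    Eval-subst⁺ : Eval Sg B ρθ t a → Eval≈ ρ (t [ θ ]) a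
    Eval-subst⁺ (var⇓ x)         = θ⇓ρθ x
    Eval-subst⁺ (op⇓ σ as eas d) = Eval≈-op (λ i → Eval-subst⁺ (eas i)) d

    EqHolds-subst⁻ : (t u : Term Sg X s) → EqHolds Sg B ρ (t [ θ ]) (u [ θ ]) → EqHolds Sg B ρθ t u
    EqHolds-subst⁻ t u (a , b , ea , eb , a≈b) =
      EqHolds-intro (Eval-subst⁻ t ea) (Eval-subst⁻ u eb) a≈b

    EqHolds-subst⁺ : EqHolds Sg B ρθ t u → EqHolds Sg B ρ (t [ θ ]) (u [ θ ])
    EqHolds-subst⁺ (a , b , ea , eb , a≈b) = EqHolds-intro (Eval-subst⁺ ea) (Eval-subst⁺ eb) a≈b

  EqHolds-elim : Eval≈ ρ t a → Eval≈ ρ u b → EqHolds Sg B ρ t u → a ≈ b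
  EqHolds-elim t⇓a u⇓b (a' , b' , ea' , eb' , a'≈b') =
    ≈.trans (Eval≈-functional t⇓a (Eval⇒Eval≈ ea')) (≈.trans a'≈b' (Eval≈-functional (Eval⇒Eval≈ eb') u⇓b))

  EqHolds-var : {ρ : ∀ {s} → X s → Car s} (x : X s) → EqHolds Sg B ρ (var x) (var x)
  EqHolds-var x = _ , _ , var⇓ x , var⇓ x , ≈.refl

  EqHolds-sym : EqHolds Sg B ρ t u → EqHolds Sg B ρ u t
  EqHolds-sym (a , b , ea , eb , a≈b) = b , a , eb , ea , ≈.sym a≈b

  EqHolds-trans : {v : Term Sg X s} → EqHolds Sg B ρ t u → EqHolds Sg B ρ u v → EqHolds Sg B ρ t v
  EqHolds-trans (a , b , ea , eb , a≈b) (b' , c , eb' , ec , b'≈c) =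
    a , c , ea , ec , ≈.trans a≈b (≈.trans (Eval-functional eb eb') b'≈c)

  EqHolds-arg : {ts : (i : arity σ) → Term Sg X (dom σ i)} →
                EqHolds Sg B ρ (op σ ts) u → ∀ i → EqHolds Sg B ρ (ts i) (ts i)
  EqHolds-arg (_ , _ , op⇓ _ as eas d , _ , _) i = as i , as i , eas i , eas i , ≈.refl

  EqHolds-cong : {ts us : (i : arity σ) → Term Sg X (dom σ i)} →
                 EqHolds Sg B ρ (op σ ts) (op σ ts) → (∀ i → EqHolds Sg B ρ (ts i) (us i)) →
                 EqHolds Sg B ρ (op σ ts) (op σ us)
  EqHolds-cong {ρ = ρ} {us = us} (_ , _ , op⇓ σ as eas d , _ , _) ts≐us =
    EqHolds-intro (Eval⇒Eval≈ (op⇓ σ as eas d)) (Eval≈-op us⇓as d) ≈.refl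
    where
    us⇓as : ∀ i → Eval≈ ρ (us i) (as i)
    us⇓as i with ts≐us i
    ... | x , y , ex , ey , x≈y = y , ey , ≈.trans (≈.sym x≈y) (Eval-functional ex (eas i))

module _ {Sg : Signature} {A B : PAlg Sg} (h : Hom Sg A B) where
  open Signature Sg
  open Hom h
  open Evaluation B
  private
    module ≈ {s} = IsEquivalence (PAlg.isEquiv B s)

  Hom-Eval : {X : Sort → Set} {ρ : ∀ {s} → X s → PAlg.Car A s} {s : Sort} {t : Term Sg X s}
             {a : PAlg.Car A s} →
             Eval Sg A ρ t a → Eval≈ (λ {s} x → map s (ρ x)) t (map s a)
  Hom-Eval (var⇓ x)         = Eval⇒Eval≈ (var⇓ x)
  Hom-Eval (op⇓ σ as eas d) =
    Eval≈-resp (Eval≈-op (λ i → Hom-Eval (eas i)) (proj₁ (preserve σ as d))) (≈.sym (proj₂ (preserve σ as d)))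

module Presentation (Sg : Signature) (T : Theory Sg) (G : Signature.Sort Sg → Set)
                    (R : (s : Signature.Sort Sg) → Term Sg G s → Term Sg G s → Set) where
  open Signature Sg
  open Substitution Sg

  -- t ≐ u: the existence equation t = u is derivable; in particular t ≐ t says that t is defined.
  infix 4 _≐_
  data _≐_ : {s : Sort} → Term Sg G s → Term Sg G s → Set where
    ≐-var   : ∀ {s} (g : G s) → var g ≐ var g
    ≐-sym   : ∀ {s} {t u : Term Sg G s} → t ≐ u → u ≐ t
    ≐-trans : ∀ {s} {t u v : Term Sg G s} → t ≐ u → u ≐ v → t ≐ v
    ≐-rel   : ∀ {s} {t u : Term Sg G s} → R s t u → t ≐ u
    ≐-arg   : ∀ {σ} {ts : (i : arity σ) → Term Sg G (dom σ i)} {u} →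
              op σ ts ≐ u → ∀ i → ts i ≐ ts i
    ≐-cong  : ∀ {σ} {ts us : (i : arity σ) → Term Sg G (dom σ i)} →
              op σ ts ≐ op σ ts → (∀ i → ts i ≐ us i) → op σ ts ≐ op σ us
    ≐-horn  : (a : Theory.Ax T) → let open Horn (Theory.ax T a) in
              (θ : ∀ {s} → Vars s → Term Sg G s) → (∀ {s} (v : Vars s) → θ v ≐ θ v) →
              (∀ j → plhs j [ θ ] ≐ prhs j [ θ ]) → clhs [ θ ] ≐ crhs [ θ ]

  ≐-reflˡ : ∀ {s} {t u : Term Sg G s} → t ≐ u → t ≐ t
  ≐-reflˡ p = ≐-trans p (≐-sym p)

  ≐-reflʳ : ∀ {s} {t u : Term Sg G s} → t ≐ u → u ≐ u
  ≐-reflʳ p = ≐-trans (≐-sym p) p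

  Defined : Sort → Set
  Defined s = Σ (Term Sg G s) λ t → t ≐ t

  termAlgebra : PAlg Sg
  termAlgebra = record
    { Car      = Defined
    ; _≈_      = λ a b → proj₁ a ≐ proj₁ b
    ; isEquiv  = λ s → record { refl = λ {a} → proj₂ a ; sym = ≐-sym ; trans = ≐-trans }
    ; Def      = λ σ as → op σ (λ i → proj₁ (as i)) ≐ op σ (λ i → proj₁ (as i))
    ; app      = λ σ as d → op σ (λ i → proj₁ (as i)) , d
    ; Def-resp = λ σ as≐bs d → ≐-reflʳ (≐-cong d as≐bs)
    ; app-resp = λ σ as≐bs d e → ≐-cong d as≐bs
    }

  generator : ∀ {s} → G s → Defined s
  generator g = var g , ≐-var g

  module TermModel where
    open Evaluation termAlgebra

    Eval⇒≐ : ∀ {s} {t : Term Sg G s} {a : Defined s} → Eval Sg termAlgebra generator t a → t ≐ proj₁ a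
    Eval⇒≐ (var⇓ g)         = ≐-var g
    Eval⇒≐ (op⇓ σ as eas d) = ≐-sym (≐-cong d (λ i → ≐-sym (Eval⇒≐ (eas i))))

    defined-Eval≈ : ∀ {s} (t : Term Sg G s) (d : t ≐ t) → Eval≈ generator t (t , d)
    defined-Eval≈ (var g)   d = _ , var⇓ g , d
    defined-Eval≈ (op σ ts) d =
      Eval≈-op {as = λ i → ts i , ≐-arg d i} (λ i → defined-Eval≈ (ts i) (≐-arg d i)) d

    EqHolds⇒≐ : ∀ {s} {t u : Term Sg G s} → EqHolds Sg termAlgebra generator t u → t ≐ u
    EqHolds⇒≐ (a , b , ea , eb , a≐b) = ≐-trans (Eval⇒≐ ea) (≐-trans a≐b (≐-sym (Eval⇒≐ eb)))

    ≐⇒EqHolds : ∀ {s} {t u : Term Sg G s} → t ≐ u → EqHolds Sg termAlgebra generator t u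
    ≐⇒EqHolds {t = t} {u} p =
      EqHolds-intro {a = t , ≐-reflˡ p} {b = u , ≐-reflʳ p}
                    (defined-Eval≈ t (≐-reflˡ p)) (defined-Eval≈ u (≐-reflʳ p)) p

    -- An assignment ρ into the term model is a substitution θ by defined terms; under it the premises of an
    -- axiom become derivable instances, and ≐-horn derives the corresponding instance of the conclusion.
    termAlgebra-satisfies : Satisfies Sg termAlgebra T
    termAlgebra-satisfies a ρ premises =
      EqHolds-subst⁻ θ⇓ρ clhs crhs
        (≐⇒EqHolds (≐-horn a θ (λ v → proj₂ (ρ v))
          (λ j → EqHolds⇒≐ (EqHolds-subst⁺ θ⇓ρ (premises j)))))
      where
      open Horn (Theory.ax T a)
      θ : ∀ {s} → Vars s → Term Sg G s
      θ v = proj₁ (ρ v)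
      θ⇓ρ : ∀ {s} (v : Vars s) → Eval≈ generator (θ v) (ρ v)
      θ⇓ρ v = defined-Eval≈ (θ v) (proj₂ (ρ v))

    termModel : PresModel Sg T G R
    termModel = record
      { model  = record { alg = termAlgebra ; sat = termAlgebra-satisfies }
      ; ϱ      = generator
      ; relsat = λ s t u r → ≐⇒EqHolds (≐-rel r)
      }

  module Universality (N : PresModel Sg T G R) where
    open PresModel N renaming (alg to B; ϱ to ϑ)
    open PAlg B using (_≈_; isEquiv; Def-resp)
    open Evaluation B
    open TermModel using (defined-Eval≈)
    private
      module ≈ {s} = IsEquivalence (isEquiv s)

    sound : ∀ {s} {t u : Term Sg G s} → t ≐ u → EqHolds Sg B ϑ t u
    sound (≐-var g)       = EqHolds-var g
    sound (≐-sym p)       = EqHolds-sym (sound p)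
    sound (≐-trans p q)   = EqHolds-trans (sound p) (sound q)
    sound (≐-rel r)       = relsat _ _ _ r
    sound (≐-arg p i)     = EqHolds-arg (sound p) i
    sound (≐-cong p ps)   = EqHolds-cong (sound p) (λ i → sound (ps i))
    sound (≐-horn a θ θ-defined premises) =
      EqHolds-subst⁺ θ⇓ρ (sat a ρ (λ j → EqHolds-subst⁻ θ⇓ρ (plhs j) (prhs j) (sound (premises j))))
      where
      open Horn (Theory.ax T a)
      ρ : ∀ {s} → Vars s → PAlg.Car B s
      ρ v = proj₁ (sound (θ-defined v))
      θ⇓ρ : ∀ {s} (v : Vars s) → Eval≈ ϑ (θ v) (ρ v)
      θ⇓ρ v = Eval⇒Eval≈ (proj₁ (proj₂ (proj₂ (sound (θ-defined v)))))

    value : ∀ s → Defined s → PAlg.Car B s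
    value s (t , d) = proj₁ (sound d)

    Eval-value : ∀ {s} (a : Defined s) → Eval Sg B ϑ (proj₁ a) (value s a)
    Eval-value (t , d) = proj₁ (proj₂ (proj₂ (sound d)))

    valueHom : Hom Sg termAlgebra B
    valueHom = record
      { map      = value
      ; map-resp = λ s {a} {b} a≐b →
          EqHolds-elim (Eval⇒Eval≈ (Eval-value a)) (Eval⇒Eval≈ (Eval-value b)) (sound a≐b)
      ; preserve = preserve
      }
      where
      preserve : (σ : Op) (as : (i : arity σ) → Defined (dom σ i)) (d : PAlg.Def termAlgebra σ as) →
                 Σ (PAlg.Def B σ (λ i → value _ (as i))) λ e →
                   value (cod σ) (PAlg.app termAlgebra σ as d) ≈ PAlg.app B σ (λ i → value _ (as i)) e
      preserve σ as d with Eval-op⁻¹ (Eval-value (PAlg.app termAlgebra σ as d))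
      ... | bs , ebs , e =
        value-Def , Eval≈-functional (Eval⇒Eval≈ (Eval-value (PAlg.app termAlgebra σ as d)))
                                     (Eval≈-op (λ i → Eval⇒Eval≈ (Eval-value (as i))) value-Def)
        where
        value-Def : PAlg.Def B σ (λ i → value _ (as i))
        value-Def = Def-resp σ (λ i → Eval-functional (ebs i) (Eval-value (as i))) e

    Extends : Hom Sg termAlgebra B → Set
    Extends h = ∀ s (g : G s) → Hom.map h s (generator g) ≈ ϑ g

    extension-Eval≈ : (h : Hom Sg termAlgebra B) → Extends h →
                ∀ {s} (a : Defined s) → Eval≈ ϑ (proj₁ a) (Hom.map h s a)
    extension-Eval≈ h h-extends {s} (t , d) with defined-Eval≈ t d
    ... | b , eb , b≐t with Hom-Eval h eb
    ... | c , ec , c≈hb =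
      Eval≈-resp (Eval-resp-valuation (λ {s} g → h-extends s g) ec) (≈.trans c≈hb (Hom.map-resp h s b≐t))

    valueHom-extends : Extends valueHom
    valueHom-extends s g = Eval-functional (Eval-value (generator g)) (var⇓ g)

    extension-unique : (h : Hom Sg termAlgebra B) → Extends h → (h' : Hom Sg termAlgebra B) → Extends h' →
                       ∀ s (a : Defined s) → Hom.map h s a ≈ Hom.map h' s a
    extension-unique h h-extends h' h'-extends s a =
      Eval≈-functional (extension-Eval≈ h h-extends a) (extension-Eval≈ h' h'-extends a)

lemma2p4 : (Sg : Signature) (T : Theory Sg) (G : Signature.Sort Sg → Set)
           (R : (s : Signature.Sort Sg) → Term Sg G s → Term Sg G s → Set) →
           Σ (PresModel Sg T G R) (IsPresented Sg T G R)
lemma2p4 Sg T G R = termModel , λ N → let open Universality N in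
  valueHom , valueHom-extends , extension-unique valueHom valueHom-extends
  where open Presentation Sg T G R
        open TermModel
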